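{- Let $J$, $M$ be finite sets; for each $j\in J$ let $\mathcal{F}_j$ be a matroid on $M$ with rank function $r_j$, let $q_j>0$, and let $f_j(S) = q_j/r_j(S)$ (with $f_j(S)=\infty$ if $r_j(S)=0$). Let $C>0$, $t_j := \lceil q_j/C\rceil$ for $j\in J$, and $J_2 := \{j\in J : t_j \ne 1\}$. Define on the ground set $M\times J_2$ the families $\mathcal{F}' := \{B \subseteq M\times J_2 : \{i : (i,j)\in B\}\in\mathcal{F}_j \text{ and } |\{i:(i,j)\in B\}|\le t_j \text{ for all } j\in J_2\}$ and $\mathcal{F}'' := \{B\subseteq M\times J_2 : |\{j\in J_2 : (i,j)\in B\}|\le 2 \text{ for all } i\in M\}$. If there is an assignment $\mathbf{S}=(S_j)_{j\in J}$ (non-empty $S_j\subseteq M$) with maximum load $\max_{i\in M}\sum_{j:i\in S_j} f_j(S_j)$ at most $C$, then there is a $B\in\mathcal{F}'\cap\mathcal{F}''$ with $|B| = \sum_{j\in J_2} t_j$.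
   Context: A matroid on $M$ is a non-empty family $\mathcal{F}\subseteq 2^M$ closed under subsets and satisfying: for $S,T\in\mathcal{F}$ with $|S|<|T|$ there is $i\in T\setminus S$ with $S\cup\{i\}\in\mathcal{F}$. Its rank function is $r(S)=\max\{|T|: T\subseteq S, T\in\mathcal{F}\}$.
   Formalization: The quotas $q_j$ and the load bound $C$ are rational numbers rather than real numbers. -}

module Defs where

open import Data.Nat as ℕ using (ℕ; zero; suc; _≤_; _<_; _≡ᵇ_)
open import Data.Bool using (Bool; true; false; if_then_else_; not)
open import Data.Fin using (Fin; zero; suc)
open import Data.Fin.Subset using (Subset; _∈_; _∉_; _⊆_; ∣_∣; _∪_; ⁅_⁆)
open import Data.Vec using (lookup; tabulate)
open import Data.Integer as ℤ using (+_)
open import Data.Rational as ℚ using (ℚ; 0ℚ; _÷_; _/_; ceiling)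
open import Data.Product using (Σ; ∃; _×_)

Family : ℕ → Set₁
Family m = Subset m → Set

record IsMatroid {m : ℕ} (F : Family m) : Set where
  field
    nonempty  : ∃ λ S → F S
    down      : ∀ {S T} → T ⊆ S → F S → F T
    exchange  : ∀ {S T} → F S → F T → ∣ S ∣ < ∣ T ∣ →
                ∃ λ i → i ∈ T × i ∉ S × F (S ∪ ⁅ i ⁆)

IsRankFunction : ∀ {m} → Family m → (Subset m → ℕ) → Set
IsRankFunction F r =
  ∀ S → (∃ λ T → T ⊆ S × F T × ∣ T ∣ ≡ r S)
      × (∀ T → T ⊆ S → F T → ∣ T ∣ ≤ r S)
  where open import Relation.Binary.PropositionalEquality using (_≡_)

data ℚ∞ : Set where
  fin : ℚ → ℚ∞
  ∞   : ℚ∞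

_+∞_ : ℚ∞ → ℚ∞ → ℚ∞
fin x +∞ fin y = fin (x ℚ.+ y)
_     +∞ _     = ∞

data _≤∞_ : ℚ∞ → ℚ∞ → Set where
  fin≤fin : ∀ {x y} → x ℚ.≤ y → fin x ≤∞ fin y
  ≤∞-top  : ∀ {x} → x ≤∞ ∞

sum∞ : ∀ {n} → (Fin n → ℚ∞) → ℚ∞
sum∞ {zero}  g = fin 0ℚ
sum∞ {suc n} g = g zero +∞ sum∞ (λ j → g (suc j))

sumℕ : ∀ {n} → (Fin n → ℕ) → ℕ
sumℕ {zero}  g = 0
sumℕ {suc n} g = g zero ℕ.+ sumℕ (λ j → g (suc j))

cost : ℚ → ℕ → ℚ∞
cost q zero    = ∞
cost q (suc k) = fin (q ℚ.* ((+ 1) / suc k))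

load : ∀ {m n} → (q : Fin n → ℚ) → (r : Fin n → Subset m → ℕ) →
       (S : Fin n → Subset m) → Fin m → ℚ∞
load q r S i = sum∞ (λ j → if lookup (S j) i then cost (q j) (r j (S j)) else fin 0ℚ)

-- t_j = ⌈ q_j / C ⌉  (a positive integer, taken as a natural number)
tval : (C : ℚ) → 0ℚ ℚ.< C → ℚ → ℕ
tval C C>0 q = ℤ.∣ ceiling (_÷_ q C {{ℚ.>-nonZero C>0}}) ∣

J₂ : ∀ {n} → (Fin n → ℕ) → Subset n
J₂ t = tabulate (λ j → not (t j ≡ᵇ 1))

-- A subset B ⊆ M × J₂ is represented by its columns B j = {i : (i,j) ∈ B},
-- with B j = ∅ for j ∉ J₂.
InGround : ∀ {m n} → Subset n → (Fin n → Subset m) → Set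
InGround J B = ∀ j → j ∉ J → ∀ i → i ∉ B j

card : ∀ {m n} → (Fin n → Subset m) → ℕ
card B = sumℕ (λ j → ∣ B j ∣)

InF′ : ∀ {m n} → (Fin n → Family m) → (t : Fin n → ℕ) → (Fin n → Subset m) → Set
InF′ F t B = ∀ j → j ∈ J₂ t → F j (B j) × ∣ B j ∣ ≤ t j

row : ∀ {m n} → Subset n → (Fin n → Subset m) → Fin m → Subset n
row J B i = tabulate (λ j → if lookup J j then lookup (B j) i else false)

InF″ : ∀ {m n} → (t : Fin n → ℕ) → (Fin n → Subset m) → Set
InF″ t B = ∀ i → ∣ row (J₂ t) B i ∣ ≤ 2

sumJ₂ : ∀ {n} → (t : Fin n → ℕ) → ℕ
sumJ₂ t = sumℕ (λ j → if lookup (J₂ t) j then t j else 0)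

-- Fix a basis T_j of each S_j, so |T_j| = r_j(S_j).  Giving every machine i ∈ T_j the
-- weight t_j / r_j(S_j) (for j ∈ J₂) is a fractional assignment that places exactly t_j units on job j;
-- it uses each pair (i, j) at most once, since t_j ≤ r_j(S_j) follows from q_j / r_j(S_j) ≤ C, and it
-- places at most 2 units on each machine, since t_j C ≤ 2 q_j when t_j ≥ 2 and the loads q_j / r_j(S_j)
-- on a machine sum to at most C.  Summing the weights proves the Hall condition for the bipartite
-- degree-constrained matching problem (demand t_j at job j, capacity 2 at every machine), and the
-- corresponding Hall theorem, proved by the usual induction (split along a tight set of jobs, or else
-- commit an edge of a job with positive demand), yields an integral B.  Every B_j ⊆ T_j is independent, so
-- B ∈ F′ ∩ F″ and |B| = Σ_{j ∈ J₂} t_j.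

module Submission where

open import Algebra.Bundles using (Ring)
import Algebra.Properties.CommutativeSemigroup as CommutativeSemigroupProperties
import Algebra.Properties.Semiring.Sum as SemiringSum
open import Data.Bool using (Bool; true; false; if_then_else_; not; _∧_; _∨_)
open import Data.Bool.Properties
  using (∧-zeroʳ; ∧-identityʳ; ∧-conicalˡ; ∧-conicalʳ; not-involutive) renaming (_≟_ to _≟ᵇ_)
open import Data.Empty using (⊥-elim)
open import Data.Fin using (Fin; zero; suc; punchIn)
open import Data.Fin.Properties using (punchInᵢ≢i; _≟_; all?; any?)
open import Data.Fin.Subset using (Subset; _∪_; _⊆_; _∈_; ∣_∣; Nonempty)
open import Data.Fin.Subset.Properties using (anySubset?)
open import Data.Integer as ℤ using (+_; +[1+_]; -[1+_])
open import Data.Integer.DivMod using (a≡a%n+[a/n]*n; n%d<d) renaming (_/_ to _/ℤ_)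
import Data.Integer.Properties as ℤₚ
open import Data.Integer.Tactic.RingSolver using (solve-∀)
open import Data.Nat as ℕ using (ℕ; zero; suc; _+_; _≤_; _<_; _⊓_; _∸_; z≤n; s≤s; z<s)
import Data.Nat.Properties as ℕₚ
open import Data.Product using (∃; _×_; _,_; proj₁; proj₂)
open import Data.Rational as ℚ using (ℚ; 0ℚ; 1ℚ)
open import Data.Rational.Literals using (fromℤ)
import Data.Rational.Properties as ℚₚ
open import Data.Rational.Unnormalised using (*≡*)
import Data.Rational.Unnormalised.Properties as ℚᵘₚ
open import Data.Sum using (_⊎_; inj₁; inj₂)
open import Data.Vec using ([]; _∷_; lookup; tabulate)
open import Data.Vec.Functional using (updateAt)
open import Data.Vec.Functional.Properties using (updateAt-updates; updateAt-minimal)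
open import Data.Vec.Properties using (lookup∘tabulate; lookup-zipWith; []=⇒lookup; lookup⇒[]=)
open import Function using (_∘_)
open import Relation.Binary.PropositionalEquality
open import Relation.Nullary using (¬_; Dec; does; yes; no; contradiction)
open import Relation.Nullary.Decidable using (dec-true; dec-false; _×-dec_; _→-dec_)

open import Defs

open SemiringSum ℕₚ.+-*-semiring
  using (sum; sum-cong-≗; sum-remove; sum-replicate-zero; ∑-distrib-+)
open CommutativeSemigroupProperties ℕₚ.+-commutativeSemigroup using (xy∙z≈xz∙y)
module ℚΣ = SemiringSum (Ring.semiring ℚₚ.+-*-ring)

sum-mono-≤ : ∀ {n} {g h : Fin n → ℕ} → (∀ k → g k ≤ h k) → sum g ≤ sum h
sum-mono-≤ {zero}  _   = z≤n
sum-mono-≤ {suc n} g≤h = ℕₚ.+-mono-≤ (g≤h zero) (sum-mono-≤ (g≤h ∘ suc))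

sum-zero : ∀ {n} {g : Fin n → ℕ} → (∀ k → g k ≡ 0) → sum g ≡ 0
sum-zero {n} g≡0 = trans (sum-cong-≗ g≡0) (sum-replicate-zero n)

sum-mono-< : ∀ {n} {g h : Fin n → ℕ} (k : Fin n) → (∀ k → g k ≤ h k) → g k < h k → sum g < sum h
sum-mono-< {suc n} {g} {h} k g≤h gk<hk = begin-strict
  sum g                                   ≡⟨ sum-remove {i = k} g ⟩
  g k + sum (g ∘ punchIn k)               <⟨ ℕₚ.+-mono-<-≤ gk<hk (sum-mono-≤ (g≤h ∘ punchIn k)) ⟩
  h k + sum (h ∘ punchIn k)               ≡⟨ sum-remove {i = k} h ⟨
  sum h                                   ∎
  where open ℕₚ.≤-Reasoning

sum-≤-except : ∀ {n} {g h : Fin n → ℕ} (i : Fin n) {x : ℕ} →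
               (∀ k → k ≢ i → g k ≤ h k) → g i ≤ h i + x → sum g ≤ sum h + x
sum-≤-except {suc n} {g} {h} i {x} off at = begin
  sum g                                   ≡⟨ sum-remove {i = i} g ⟩
  g i + sum (g ∘ punchIn i)               ≤⟨ ℕₚ.+-mono-≤ at (sum-mono-≤ λ k → off _ (punchInᵢ≢i i k)) ⟩
  h i + x + sum (h ∘ punchIn i)           ≡⟨ xy∙z≈xz∙y (h i) x _ ⟩
  h i + sum (h ∘ punchIn i) + x           ≡⟨ cong (_+ x) (sum-remove {i = i} h) ⟨
  sum h + x                               ∎
  where open ℕₚ.≤-Reasoning

sum-≡-except : ∀ {n} {g h : Fin n → ℕ} (i : Fin n) {x : ℕ} →
               (∀ k → k ≢ i → g k ≡ h k) → g i ≡ h i + x → sum g ≡ sum h + x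
sum-≡-except {suc n} {g} {h} i {x} off at = begin
  sum g                                   ≡⟨ sum-remove {i = i} g ⟩
  g i + sum (g ∘ punchIn i)               ≡⟨ cong₂ _+_ at (sum-cong-≗ λ k → off _ (punchInᵢ≢i i k)) ⟩
  h i + x + sum (h ∘ punchIn i)           ≡⟨ xy∙z≈xz∙y (h i) x _ ⟩
  h i + sum (h ∘ punchIn i) + x           ≡⟨ cong (_+ x) (sum-remove {i = i} h) ⟨
  sum h + x                               ∎
  where open ≡-Reasoning

sum-single : ∀ {n} {g : Fin n → ℕ} (i : Fin n) → (∀ k → k ≢ i → g k ≡ 0) → sum g ≡ g i
sum-single {n} i off = trans (sum-≡-except i off refl) (cong (_+ _) (sum-replicate-zero n))

zero-or-positive : ∀ {n} (g : Fin n → ℕ) → (∀ k → g k ≡ 0) ⊎ ∃ λ k → 0 < g k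
zero-or-positive {zero}  g = inj₁ λ ()
zero-or-positive {suc n} g with g zero in g₀ | zero-or-positive (g ∘ suc)
... | suc _ | _             = inj₂ (zero , subst (0 <_) (sym g₀) z<s)
... | zero  | inj₂ (k , gk) = inj₂ (suc k , gk)
... | zero  | inj₁ rest     = inj₁ λ { zero → g₀ ; (suc k) → rest k }

sum-positive : ∀ {n} (g : Fin n → ℕ) → 0 < sum g → ∃ λ k → 0 < g k
sum-positive g pos with zero-or-positive g
... | inj₂ found = found
... | inj₁ g≡0   = contradiction (sym (sum-zero g≡0)) (ℕₚ.<⇒≢ pos)

sumℕ≡sum : ∀ {n} (g : Fin n → ℕ) → sumℕ g ≡ sum g
sumℕ≡sum {zero}  g = refl
sumℕ≡sum {suc n} g = cong (λ s → g zero + s) (sumℕ≡sum (g ∘ suc))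

⊓-+-≤ : ∀ c a b → c ⊓ (a + b) ≤ c ⊓ a + c ⊓ b
⊓-+-≤ zero    a       b = z≤n
⊓-+-≤ (suc c) zero    b = ℕₚ.≤-refl
⊓-+-≤ (suc c) (suc a) b =
  s≤s (ℕₚ.≤-trans (⊓-+-≤ c a b) (ℕₚ.+-monoʳ-≤ (c ⊓ a) (ℕₚ.⊓-monoˡ-≤ b (ℕₚ.n≤1+n c))))

⊓-+-residual : ∀ c a b {u} → u ≤ c → u ≤ a → c ⊓ (a + b) ≤ c ⊓ a + (c ∸ u) ⊓ b
⊓-+-residual c       a       b {zero}  _         _         = ⊓-+-≤ c a b
⊓-+-residual (suc c) (suc a) b {suc u} (s≤s u≤c) (s≤s u≤a) = s≤s (⊓-+-residual c a b u≤c u≤a)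

suc-⊓-≤ : ∀ γ {x y} → x ≤ y + 1 → suc γ ⊓ x ≤ γ ⊓ y + 1
suc-⊓-≤ γ {x} {y} x≤y+1 = begin
  suc γ ⊓ x           ≤⟨ ℕₚ.⊓-monoʳ-≤ (suc γ) x≤y+1 ⟩
  suc γ ⊓ (y + 1)     ≡⟨ cong (_⊓ (y + 1)) (ℕₚ.+-comm 1 γ) ⟩
  (γ + 1) ⊓ (y + 1)   ≡⟨ ℕₚ.+-distribʳ-⊓ 1 γ y ⟨
  γ ⊓ y + 1           ∎
  where open ℕₚ.≤-Reasoning

suc≤double : ∀ k → not (suc k ℕ.≡ᵇ 1) ≡ true → suc k ≤ k + k
suc≤double zero    ()
suc≤double (suc k) _ = s≤s (ℕₚ.m≤n+m (suc k) k)


𝟙 : Bool → ℕ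
𝟙 true  = 1
𝟙 false = 0

𝟙≤1 : ∀ b → 𝟙 b ≤ 1
𝟙≤1 true  = ℕₚ.≤-refl
𝟙≤1 false = z≤n

if-𝟙≤1 : ∀ b x → (if b then 𝟙 x else 0) ≤ 1
if-𝟙≤1 true  x = 𝟙≤1 x
if-𝟙≤1 false x = z≤n

𝟙-mono : ∀ {a b} → (a ≡ true → b ≡ true) → 𝟙 a ≤ 𝟙 b
𝟙-mono {false}         _   = z≤n
𝟙-mono {true}  {true}  _   = ℕₚ.≤-refl
𝟙-mono {true}  {false} a⇒b with a⇒b refl
... | ()

_⊆ᵇ_ : ∀ {n} → (Fin n → Bool) → (Fin n → Bool) → Set
K ⊆ᵇ P = ∀ j → K j ≡ true → P j ≡ true

_∪ᵇ_ : ∀ {n} → (Fin n → Bool) → (Fin n → Bool) → Fin n → Bool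
(K ∪ᵇ L) j = K j ∨ L j

count : ∀ {n} → (Fin n → Bool) → ℕ
count K = sum (𝟙 ∘ K)

count-mono-< : ∀ {n} {K P : Fin n → Bool} → K ⊆ᵇ P → ∀ y → P y ≡ true → K y ≡ false → count K < count P
count-mono-< {K = K} {P} K⊆P y Py Ky = sum-mono-< y (λ j → 𝟙-mono (K⊆P j))
  (subst₂ (λ a b → 𝟙 a < 𝟙 b) (sym Ky) (sym Py) z<s)

∣p∣≡count : ∀ {n} (p : Subset n) → ∣ p ∣ ≡ count (lookup p)
∣p∣≡count []          = refl
∣p∣≡count (true ∷ p)  = cong suc (∣p∣≡count p)
∣p∣≡count (false ∷ p) = ∣p∣≡count p

sumOver : ∀ {n} → (Fin n → Bool) → (Fin n → ℕ) → ℕ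
sumOver K g = sum λ j → if K j then g j else 0

syntax sumOver K (λ j → x) = ∑[ j ∈ K ] x

sumOver-cong : ∀ {n} (K : Fin n → Bool) {g h : Fin n → ℕ} →
               (∀ j → K j ≡ true → g j ≡ h j) → sumOver K g ≡ sumOver K h
sumOver-cong K g≡h = sum-cong-≗ λ j → pointwise j (K j) refl
  where
  pointwise : ∀ j b → K j ≡ b → (if b then _ else 0) ≡ (if b then _ else 0)
  pointwise j true  Kj = g≡h j Kj
  pointwise j false _  = refl

sumOver-≗ : ∀ {n} {K L : Fin n → Bool} (g : Fin n → ℕ) → (∀ j → K j ≡ L j) → sumOver K g ≡ sumOver L g
sumOver-≗ g K≗L = sum-cong-≗ λ j → cong (λ b → if b then g j else 0) (K≗L j)

sumOver-mono-≤ : ∀ {n} (K : Fin n → Bool) {g h : Fin n → ℕ} →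
                 (∀ j → g j ≤ h j) → sumOver K g ≤ sumOver K h
sumOver-mono-≤ K g≤h = sum-mono-≤ λ j → pointwise j (K j)
  where
  pointwise : ∀ j b → (if b then _ else 0) ≤ (if b then _ else 0)
  pointwise j true  = g≤h j
  pointwise j false = z≤n

sumOver-zero : ∀ {n} (K : Fin n → Bool) {g : Fin n → ℕ} → (∀ j → K j ≡ true → g j ≡ 0) → sumOver K g ≡ 0
sumOver-zero K g≡0 = trans (sumOver-cong K g≡0) (sum-zero λ j → pointwise (K j))
  where
  pointwise : ∀ b → (if b then 0 else 0) ≡ 0
  pointwise true  = refl
  pointwise false = refl

sumOver-∪ : ∀ {n} {K L : Fin n → Bool} (g : Fin n → ℕ) → (∀ j → K j ≡ true → L j ≡ false) →
            sumOver (K ∪ᵇ L) g ≡ sumOver K g + sumOver L g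
sumOver-∪ {K = K} {L} g disjoint =
  trans (sum-cong-≗ λ j → split (K j) (L j) (disjoint j))
        (∑-distrib-+ (λ j → if K j then g j else 0) (λ j → if L j then g j else 0))
  where
  split : ∀ a b {x} → (a ≡ true → b ≡ false) →
          (if a ∨ b then x else 0) ≡ (if a then x else 0) + (if b then x else 0)
  split true  true  disj with disj refl
  ... | ()
  split true  false _ = sym (ℕₚ.+-identityʳ _)
  split false _     _ = refl

singleton : ∀ {n} → Fin n → Fin n → Bool
singleton j k = does (k ≟ j)

singleton-≡ : ∀ {n} {j k : Fin n} → singleton j k ≡ true → k ≡ j
singleton-≡ {j = j} {k} with k ≟ j
... | yes k≡j = λ _ → k≡j
... | no  _   = λ ()

sumOver-singleton : ∀ {n} (j : Fin n) (g : Fin n → ℕ) → ∑[ k ∈ singleton j ] g k ≡ g j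
sumOver-singleton j g = trans (sum-single j off) (cong (λ b → if b then g j else 0) (dec-true (j ≟ j) refl))
  where
  off : ∀ k → k ≢ j → (if singleton j k then g k else 0) ≡ 0
  off k k≢j rewrite dec-false (k ≟ j) k≢j = refl

set : ∀ {n m} {X : Set} → (Fin n → Fin m → X) → Fin n → Fin m → X → Fin n → Fin m → X
set A j i x = updateAt A j λ row → updateAt row i λ _ → x

module _ {n m : ℕ} {X : Set} (A : Fin n → Fin m → X) (j : Fin n) (i : Fin m) (x : X) where

  set-at : set A j i x j i ≡ x
  set-at = trans (cong (λ row → row i) (updateAt-updates j A)) (updateAt-updates i (A j))

  set-off-row : ∀ {j′ k} → j′ ≢ j → set A j i x j′ k ≡ A j′ k
  set-off-row {k = k} j′≢j = cong (λ row → row k) (updateAt-minimal _ j A j′≢j)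

  set-off-column : ∀ {j′ k} → k ≢ i → set A j i x j′ k ≡ A j′ k
  set-off-column {j′} {k} k≢i with j′ ≟ j
  ... | yes refl = trans (cong (λ row → row k) (updateAt-updates j A)) (updateAt-minimal k i (A j) k≢i)
  ... | no j′≢j  = set-off-row j′≢j

  set-cases : ∀ j′ k → (j′ ≡ j × k ≡ i) ⊎ set A j i x j′ k ≡ A j′ k
  set-cases j′ k with j′ ≟ j | k ≟ i
  ... | yes j′≡j | yes k≡i = inj₁ (j′≡j , k≡i)
  ... | yes _    | no k≢i  = inj₂ (set-off-column k≢i)
  ... | no j′≢j  | _       = inj₂ (set-off-row j′≢j)


-- Hall's theorem for degree-constrained bipartite matchings

module _ {m n : ℕ} where

  degree : (Fin n → Fin m → Bool) → (Fin n → Bool) → Fin m → ℕ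
  degree A K i = ∑[ j ∈ K ] 𝟙 (A j i)

  supply : (Fin n → Fin m → Bool) → (Fin m → ℕ) → (Fin n → Bool) → ℕ
  supply A c K = sum λ i → c i ⊓ degree A K i

  -- K ranges over Subset rather than Fin n → Bool so that the existence of a tight set is decidable.
  HallCondition : (Fin n → Fin m → Bool) → (Fin n → ℕ) → (Fin m → ℕ) → (Fin n → Bool) → Set
  HallCondition A d c P = ∀ (K : Subset n) → lookup K ⊆ᵇ P → ∑[ j ∈ lookup K ] d j ≤ supply A c (lookup K)

  record Matching (A : Fin n → Fin m → Bool) (d : Fin n → ℕ) (c : Fin m → ℕ) (P : Fin n → Bool) : Set where
    field
      edge      : Fin n → Fin m → Bool
      edge⊆A    : ∀ j → edge j ⊆ᵇ A j
      saturated : ∀ j → P j ≡ true → count (edge j) ≡ d j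
      within    : ∀ i → degree edge P i ≤ c i

  degree-mono : ∀ {A B : Fin n → Fin m → Bool} (K : Fin n → Bool) → (∀ j → B j ⊆ᵇ A j) →
                ∀ i → degree B K i ≤ degree A K i
  degree-mono K B⊆A i = sumOver-mono-≤ K λ j → 𝟙-mono (B⊆A j i)

  degree-∪ : ∀ (A : Fin n → Fin m → Bool) {K L : Fin n → Bool} → (∀ j → K j ≡ true → L j ≡ false) →
             ∀ i → degree A (K ∪ᵇ L) i ≡ degree A K i + degree A L i
  degree-∪ A disjoint i = sumOver-∪ (λ j → 𝟙 (A j i)) disjoint

  degree-≤-except : ∀ {B B′ : Fin n → Fin m → Bool} (K : Fin n → Bool) (j : Fin n) (i : Fin m) →
                    (∀ k → k ≢ j → B k i ≡ B′ k i) → degree B K i ≤ degree B′ K i + 1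
  degree-≤-except K j i off = sum-≤-except j
    (λ k k≢j → ℕₚ.≤-reflexive (cong (λ b → if K k then 𝟙 b else 0) (off k k≢j)))
    (ℕₚ.≤-trans (if-𝟙≤1 (K j) _) (ℕₚ.m≤n+m 1 _))

  degree-set-off : ∀ (B : Fin n → Fin m → Bool) j i x K {k} → k ≢ i → degree (set B j i x) K k ≡ degree B K k
  degree-set-off B j i x K k≢i = sumOver-cong K λ j′ _ → cong 𝟙 (set-off-column B j i x k≢i)

  empty-matching : ∀ {A d c P} → (∀ j → P j ≡ true → d j ≡ 0) → Matching A d c P
  empty-matching {P = P} no-demand = record
    { edge      = λ _ _ → false
    ; edge⊆A    = λ _ _ ()
    ; saturated = λ j Pj → trans (sum-replicate-zero m) (sym (no-demand j Pj))
    ; within    = λ i → ℕₚ.≤-trans (ℕₚ.≤-reflexive (sumOver-zero P λ _ _ → refl)) z≤n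
    }

  hall-singleton : ∀ {A d c P j} → HallCondition A d c P → P j ≡ true →
                   d j ≤ sum λ i → c i ⊓ 𝟙 (A j i)
  hall-singleton {A} {d} {c} {P} {j} H Pj = begin
    d j                                         ≡⟨ sumOver-singleton j d ⟨
    ∑[ k ∈ singleton j ] d k                    ≡⟨ sumOver-≗ d Kⱼ≗ ⟨
    ∑[ k ∈ lookup Kⱼ ] d k                      ≤⟨ H Kⱼ Kⱼ⊆P ⟩
    supply A c (lookup Kⱼ)                      ≡⟨ sum-cong-≗ (λ i → cong (c i ⊓_) (degree-Kⱼ i)) ⟩
    (sum λ i → c i ⊓ 𝟙 (A j i))                 ∎
    where
    open ℕₚ.≤-Reasoning
    Kⱼ : Subset n
    Kⱼ = tabulate (singleton j)
    Kⱼ≗ : ∀ k → lookup Kⱼ k ≡ singleton j k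
    Kⱼ≗ = lookup∘tabulate (singleton j)
    Kⱼ⊆P : lookup Kⱼ ⊆ᵇ P
    Kⱼ⊆P k Kk = subst (λ k → P k ≡ true) (sym (singleton-≡ (trans (sym (Kⱼ≗ k)) Kk))) Pj
    degree-Kⱼ : ∀ i → degree A (lookup Kⱼ) i ≡ 𝟙 (A j i)
    degree-Kⱼ i = trans (sumOver-≗ (λ k → 𝟙 (A k i)) Kⱼ≗) (sumOver-singleton j (λ k → 𝟙 (A k i)))

  find-edge : ∀ {A d c P j} → HallCondition A d c P → P j ≡ true → 0 < d j → ∃ λ i → A j i ≡ true × 0 < c i
  find-edge {A} {c = c} {j = j} H Pj dj>0 with sum-positive _ (ℕₚ.<-≤-trans dj>0 (hall-singleton H Pj))
  ... | i , pos = i , edge-and-capacity (A j i) pos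
    where
    edge-and-capacity : ∀ b → 0 < c i ⊓ 𝟙 b → b ≡ true × 0 < c i
    edge-and-capacity true  pos = refl , ℕₚ.<-≤-trans pos (ℕₚ.m⊓n≤m (c i) 1)
    edge-and-capacity false pos with () ← ℕₚ.<-irrefl refl (subst (0 <_) (ℕₚ.⊓-zeroʳ (c i)) pos)

  Tight : (Fin n → Fin m → Bool) → (Fin n → ℕ) → (Fin m → ℕ) → (Fin n → Bool) → Subset n → Set
  Tight A d c P K = lookup K ⊆ᵇ P × (∃ λ x → lookup K x ≡ true) × (∃ λ y → P y ≡ true × lookup K y ≡ false)
                    × supply A c (lookup K) ≤ ∑[ j ∈ lookup K ] d j

  tight? : ∀ A d c P K → Dec (Tight A d c P K)
  tight? A d c P K =
    all? (λ j → (lookup K j ≟ᵇ true) →-dec (P j ≟ᵇ true))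
    ×-dec any? (λ x → lookup K x ≟ᵇ true)
    ×-dec any? (λ y → (P y ≟ᵇ true) ×-dec (lookup K y ≟ᵇ false))
    ×-dec (supply A c (lookup K) ℕ.≤? ∑[ j ∈ lookup K ] d j)

  -- A matching of a tight K exhausts the supply of K, so the other jobs still satisfy Hall's
  -- condition for the capacities left over.
  module TightSplit {A d c P} (H : HallCondition A d c P) (K : Subset n) (K⊆P : lookup K ⊆ᵇ P)
                    (K-tight : supply A c (lookup K) ≤ ∑[ j ∈ lookup K ] d j) where

    rest : Fin n → Bool
    rest j = P j ∧ not (lookup K j)

    rest⊆P : rest ⊆ᵇ P
    rest⊆P j = ∧-conicalˡ (P j) _

    K-disjoint-rest : ∀ j → lookup K j ≡ true → rest j ≡ false
    K-disjoint-rest j Kj rewrite Kj = ∧-zeroʳ (P j)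

    rest⇒∉K : ∀ j → rest j ≡ true → lookup K j ≡ false
    rest⇒∉K j restj = trans (sym (not-involutive _)) (cong not (∧-conicalʳ (P j) _ restj))

    P≗K∪rest : ∀ j → P j ≡ (lookup K j ∨ rest j)
    P≗K∪rest j with lookup K j in Kj
    ... | true  = K⊆P j Kj
    ... | false = sym (∧-identityʳ (P j))

    hall-K : HallCondition A d c (lookup K)
    hall-K L L⊆K = H L λ j → K⊆P j ∘ L⊆K j

    residual : Matching A d c (lookup K) → Fin m → ℕ
    residual M i = c i ∸ degree (Matching.edge M) (lookup K) i

    hall-rest : (M : Matching A d c (lookup K)) → HallCondition A d (residual M) rest
    hall-rest M L L⊆rest = ℕₚ.+-cancelˡ-≤ (∑[ j ∈ lookup K ] d j) _ _ (begin
      ∑[ j ∈ lookup K ] d j + ∑[ j ∈ lookup L ] d j          ≡⟨ sumOver-∪ d disjoint ⟨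
      ∑[ j ∈ lookup K ∪ᵇ lookup L ] d j                       ≡⟨ sumOver-≗ d K∪L≗ ⟨
      ∑[ j ∈ lookup (K ∪ L) ] d j                             ≤⟨ H (K ∪ L) K∪L⊆P ⟩
      supply A c (lookup (K ∪ L))                             ≤⟨ sum-mono-≤ split ⟩
      (sum λ i → c i ⊓ degree A (lookup K) i + residual M i ⊓ degree A (lookup L) i)
                                                              ≡⟨ ∑-distrib-+ (λ i → c i ⊓ degree A (lookup K) i) _ ⟩
      supply A c (lookup K) + supply A (residual M) (lookup L) ≤⟨ ℕₚ.+-monoˡ-≤ _ K-tight ⟩
      ∑[ j ∈ lookup K ] d j + supply A (residual M) (lookup L) ∎)
      where
      open ℕₚ.≤-Reasoning
      open Matching M
      disjoint : ∀ j → lookup K j ≡ true → lookup L j ≡ false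
      disjoint j Kj with lookup L j in Lj
      ... | false = refl
      ... | true  = trans (sym (L⊆rest j Lj)) (K-disjoint-rest j Kj)
      K∪L≗ : ∀ j → lookup (K ∪ L) j ≡ (lookup K j ∨ lookup L j)
      K∪L≗ j = lookup-zipWith _∨_ j K L
      K∪L⊆P : lookup (K ∪ L) ⊆ᵇ P
      K∪L⊆P j KLj with lookup K j in Kj
      ... | true  = K⊆P j Kj
      ... | false = rest⊆P j (L⊆rest j (subst (λ b → b ∨ lookup L j ≡ true) Kj (trans (sym (K∪L≗ j)) KLj)))
      split : ∀ i → c i ⊓ degree A (lookup (K ∪ L)) i ≤
                    c i ⊓ degree A (lookup K) i + residual M i ⊓ degree A (lookup L) i
      split i = begin
        c i ⊓ degree A (lookup (K ∪ L)) i
          ≡⟨ cong (c i ⊓_) (sumOver-≗ (λ j → 𝟙 (A j i)) K∪L≗) ⟩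
        c i ⊓ degree A (lookup K ∪ᵇ lookup L) i
          ≡⟨ cong (c i ⊓_) (degree-∪ A disjoint i) ⟩
        c i ⊓ (degree A (lookup K) i + degree A (lookup L) i)
          ≤⟨ ⊓-+-residual (c i) _ _ (within i) (degree-mono (lookup K) edge⊆A i) ⟩
        c i ⊓ degree A (lookup K) i + residual M i ⊓ degree A (lookup L) i
          ∎

    combine : (M₁ : Matching A d c (lookup K)) → Matching A d (residual M₁) rest → Matching A d c P
    combine M₁ M₂ = record { edge = edge ; edge⊆A = edge⊆A ; saturated = saturated ; within = within }
      where
      module M₁ = Matching M₁
      module M₂ = Matching M₂
      edge : Fin n → Fin m → Bool
      edge j = if lookup K j then M₁.edge j else M₂.edge j
      edge⊆A : ∀ j → edge j ⊆ᵇ A j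
      edge⊆A j with lookup K j
      ... | true  = M₁.edge⊆A j
      ... | false = M₂.edge⊆A j
      saturated : ∀ j → P j ≡ true → count (edge j) ≡ d j
      saturated j Pj with lookup K j in Kj
      ... | true  = M₁.saturated j Kj
      ... | false = M₂.saturated j (trans (cong (λ b → P j ∧ not b) Kj) (trans (∧-identityʳ (P j)) Pj))
      on-K : ∀ i j → lookup K j ≡ true → 𝟙 (edge j i) ≡ 𝟙 (M₁.edge j i)
      on-K i j Kj rewrite Kj = refl
      on-rest : ∀ i j → rest j ≡ true → 𝟙 (edge j i) ≡ 𝟙 (M₂.edge j i)
      on-rest i j restj rewrite rest⇒∉K j restj = refl
      within : ∀ i → degree edge P i ≤ c i
      within i = begin
        degree edge P i                                   ≡⟨ sumOver-≗ (λ j → 𝟙 (edge j i)) P≗K∪rest ⟩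
        degree edge (lookup K ∪ᵇ rest) i                  ≡⟨ degree-∪ edge K-disjoint-rest i ⟩
        degree edge (lookup K) i + degree edge rest i     ≡⟨ cong₂ _+_ (sumOver-cong (lookup K) (on-K i))
                                                                       (sumOver-cong rest (on-rest i)) ⟩
        used + degree M₂.edge rest i                      ≤⟨ ℕₚ.+-monoʳ-≤ used (M₂.within i) ⟩
        used + (c i ∸ used)                               ≡⟨ ℕₚ.m+[n∸m]≡n (M₁.within i) ⟩
        c i                                               ∎
        where
        open ℕₚ.≤-Reasoning
        used = degree M₁.edge (lookup K) i

  -- Without tight sets every nonempty K ⊊ P has slack at least 1, so Hall's condition survives
  -- committing an edge (j, i): remove it and lower the demand of j and the capacity of i by one.
  module AssignEdge {A d c P} (H : HallCondition A d c P) (no-tight : ∀ K → ¬ Tight A d c P K)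
                    {j i} (Pj : P j ≡ true) (dj>0 : 0 < d j) (Aji : A j i ≡ true) (ci>0 : 0 < c i) where

    A′ : Fin n → Fin m → Bool
    A′ = set A j i false

    d′ : Fin n → ℕ
    d′ = updateAt d j ℕ.pred

    c′ : Fin m → ℕ
    c′ = updateAt c i ℕ.pred

    d′-at : d′ j + 1 ≡ d j
    d′-at = trans (cong (_+ 1) (updateAt-updates j d))
                  (trans (ℕₚ.+-comm _ 1) (ℕₚ.suc-pred (d j) {{ℕ.>-nonZero dj>0}}))

    c′-at : c′ i + 1 ≡ c i
    c′-at = trans (cong (_+ 1) (updateAt-updates i c))
                  (trans (ℕₚ.+-comm _ 1) (ℕₚ.suc-pred (c i) {{ℕ.>-nonZero ci>0}}))

    demand-drop : ∀ K → ∑[ k ∈ K ] d k ≡ ∑[ k ∈ K ] d′ k + 𝟙 (K j)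
    demand-drop K = sum-≡-except j off (at (K j))
      where
      off : ∀ k → k ≢ j → (if K k then d k else 0) ≡ (if K k then d′ k else 0)
      off k k≢j = cong (λ x → if K k then x else 0) (sym (updateAt-minimal k j d k≢j))
      at : ∀ b → (if b then d j else 0) ≡ (if b then d′ j else 0) + 𝟙 b
      at true  = sym d′-at
      at false = refl

    supply-drop : ∀ K → supply A c K ≤ supply A′ c′ K + 1
    supply-drop K = sum-≤-except i off at
      where
      off : ∀ k → k ≢ i → c k ⊓ degree A K k ≤ c′ k ⊓ degree A′ K k
      off k k≢i = ℕₚ.≤-reflexive
        (sym (cong₂ _⊓_ (updateAt-minimal k i c k≢i) (degree-set-off A j i false K k≢i)))
      at : c i ⊓ degree A K i ≤ c′ i ⊓ degree A′ K i + 1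
      at = subst (λ x → x ⊓ degree A K i ≤ c′ i ⊓ degree A′ K i + 1) (trans (ℕₚ.+-comm 1 _) c′-at)
                 (suc-⊓-≤ (c′ i) (degree-≤-except {A} {A′} K j i
                   λ k k≢j → sym (set-off-row A j i false k≢j)))

    demand-drop-at : ∀ K → K j ≡ true → ∑[ k ∈ K ] d k ≡ ∑[ k ∈ K ] d′ k + 1
    demand-drop-at K Kj = trans (demand-drop K) (cong (λ b → ∑[ k ∈ K ] d′ k + 𝟙 b) Kj)

    demand-keep : ∀ K → K j ≡ false → ∑[ k ∈ K ] d′ k ≡ ∑[ k ∈ K ] d k
    demand-keep K Kj =
      sym (trans (demand-drop K) (trans (cong (λ b → ∑[ k ∈ K ] d′ k + 𝟙 b) Kj) (ℕₚ.+-identityʳ _)))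

    demand-decreases : ∑[ k ∈ P ] d′ k < ∑[ k ∈ P ] d k
    demand-decreases = subst (∑[ k ∈ P ] d′ k <_) (sym (demand-drop-at P Pj)) (ℕₚ.m<m+n _ z<s)

    hall′ : HallCondition A′ d′ c′ P
    hall′ K K⊆P with lookup K j in Kj
    ... | true  = ℕₚ.+-cancelʳ-≤ 1 _ _ (begin
      ∑[ k ∈ lookup K ] d′ k + 1     ≡⟨ demand-drop-at (lookup K) Kj ⟨
      ∑[ k ∈ lookup K ] d k          ≤⟨ H K K⊆P ⟩
      supply A c (lookup K)          ≤⟨ supply-drop (lookup K) ⟩
      supply A′ c′ (lookup K) + 1    ∎)
      where open ℕₚ.≤-Reasoning
    ... | false with any? (λ x → lookup K x ≟ᵇ true)
    ...   | no empty =
      ℕₚ.≤-trans (ℕₚ.≤-reflexive (sumOver-zero (lookup K) λ x Kx → ⊥-elim (empty (x , Kx)))) z≤n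
    ...   | yes nonempty = ℕₚ.≤-pred (subst (∑[ k ∈ lookup K ] d′ k <_) (ℕₚ.+-comm _ 1) (begin-strict
      ∑[ k ∈ lookup K ] d′ k         ≡⟨ demand-keep (lookup K) Kj ⟩
      ∑[ k ∈ lookup K ] d k          <⟨ ℕₚ.≰⇒> (λ tight → no-tight K (K⊆P , nonempty , (j , Pj , Kj) , tight)) ⟩
      supply A c (lookup K)          ≤⟨ supply-drop (lookup K) ⟩
      supply A′ c′ (lookup K) + 1    ∎))
      where open ℕₚ.≤-Reasoning

    A′⊆A : ∀ j′ → A′ j′ ⊆ᵇ A j′
    A′⊆A j′ k A′k with set-cases A j i false j′ k
    ... | inj₁ (refl , refl) with () ← trans (sym A′k) (set-at A j i false)
    ... | inj₂ eq = trans (sym eq) A′k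

    module Extend (M : Matching A′ d′ c′ P) where
      open Matching M renaming (edge to edge′; edge⊆A to edge′⊆A′; saturated to saturated′; within to within′)

      edge : Fin n → Fin m → Bool
      edge = set edge′ j i true

      edge′-at : edge′ j i ≡ false
      edge′-at with edge′ j i in e
      ... | false = refl
      ... | true  with () ← trans (sym (edge′⊆A′ j i e)) (set-at A j i false)

      edge⊆A : ∀ j′ → edge j′ ⊆ᵇ A j′
      edge⊆A j′ k e with set-cases edge′ j i true j′ k
      ... | inj₁ (refl , refl) = Aji
      ... | inj₂ eq = A′⊆A j′ k (edge′⊆A′ j′ k (trans (sym eq) e))

      saturated : ∀ j′ → P j′ ≡ true → count (edge j′) ≡ d j′
      saturated j′ Pj′ with j′ ≟ j
      ... | yes refl = begin
        count (edge j)               ≡⟨ sum-≡-except i (λ k k≢i → cong 𝟙 (set-off-column edge′ j i true k≢i)) at ⟩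
        count (edge′ j) + 1          ≡⟨ cong (_+ 1) (saturated′ j Pj′) ⟩
        d′ j + 1                     ≡⟨ d′-at ⟩
        d j                          ∎
        where
        open ≡-Reasoning
        at : 𝟙 (edge j i) ≡ 𝟙 (edge′ j i) + 1
        at = trans (cong 𝟙 (set-at edge′ j i true)) (cong (λ b → 𝟙 b + 1) (sym edge′-at))
      ... | no j′≢j = begin
        count (edge j′)              ≡⟨ sum-cong-≗ {x = 𝟙 ∘ edge j′} (λ k → cong 𝟙 (set-off-row edge′ j i true j′≢j)) ⟩
        count (edge′ j′)             ≡⟨ saturated′ j′ Pj′ ⟩
        d′ j′                        ≡⟨ updateAt-minimal j′ j d j′≢j ⟩
        d j′                         ∎
        where open ≡-Reasoning

      within : ∀ k → degree edge P k ≤ c k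
      within k with k ≟ i
      ... | yes refl = begin
        degree edge P i              ≤⟨ degree-≤-except {edge} {edge′} P j i (λ _ j′≢j → set-off-row edge′ j i true j′≢j) ⟩
        degree edge′ P i + 1         ≤⟨ ℕₚ.+-monoˡ-≤ 1 (within′ i) ⟩
        c′ i + 1                     ≡⟨ c′-at ⟩
        c i                          ∎
        where open ℕₚ.≤-Reasoning
      ... | no k≢i = begin
        degree edge P k              ≡⟨ degree-set-off edge′ j i true P k≢i ⟩
        degree edge′ P k             ≤⟨ within′ k ⟩
        c′ k                         ≡⟨ updateAt-minimal k i c k≢i ⟩
        c k                          ∎
        where open ℕₚ.≤-Reasoning

    extend : Matching A′ d′ c′ P → Matching A d c P
    extend M = record { edge = edge ; edge⊆A = edge⊆A ; saturated = saturated ; within = within }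
      where open Extend M

  private
    if-positive : ∀ b x → 0 < (if b then x else 0) → b ≡ true × 0 < x
    if-positive true x pos = refl , pos

    HallBelow : ℕ → Set
    HallBelow N = ∀ {A d c P} → count P < N → HallCondition A d c P → Matching A d c P

    hall-by-demand : ∀ {N} → HallBelow N → ∀ D {A d c P} →
                     count P < suc N → ∑[ j ∈ P ] d j < D → HallCondition A d c P → Matching A d c P
    hall-by-demand rec zero    _ () _
    hall-by-demand rec (suc D) {A} {d} {c} {P} countP<N demandP<D H
      with zero-or-positive (λ j → if P j then d j else 0)
    ... | inj₁ no-demand = empty-matching λ j Pj → subst (λ b → (if b then d j else 0) ≡ 0) Pj (no-demand j)
    ... | inj₂ (j , pos) with anySubset? (tight? A d c P)
    ...   | yes (K , K⊆P , (x , Kx) , (y , Py , Ky) , K-tight) = combine M₁ M₂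
      where
      open TightSplit H K K⊆P K-tight
      M₁ = rec (ℕₚ.<-≤-trans (count-mono-< K⊆P y Py Ky) (ℕₚ.≤-pred countP<N)) hall-K
      M₂ = rec (ℕₚ.<-≤-trans (count-mono-< rest⊆P x (K⊆P x Kx) (K-disjoint-rest x Kx)) (ℕₚ.≤-pred countP<N))
               (hall-rest M₁)
    ...   | no no-tight with if-positive (P j) (d j) pos
    ...     | Pj , dj>0 with find-edge H Pj dj>0
    ...       | i , Aji , ci>0 =
      extend (hall-by-demand rec D countP<N (ℕₚ.<-≤-trans demand-decreases (ℕₚ.≤-pred demandP<D)) hall′)
      where open AssignEdge H (λ K tight → no-tight (K , tight)) Pj dj>0 Aji ci>0

    hall-below : ∀ N → HallBelow N
    hall-below zero    ()
    hall-below (suc N) countP<N = hall-by-demand (hall-below N) _ countP<N (ℕₚ.n<1+n _)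

  hall : ∀ {A d c P} → HallCondition A d c P → Matching A d c P
  hall = hall-below _ (ℕₚ.n<1+n _)


sumℚ-mono-≤ : ∀ {n} {g h : Fin n → ℚ} → (∀ k → g k ℚ.≤ h k) → ℚΣ.sum g ℚ.≤ ℚΣ.sum h
sumℚ-mono-≤ {zero}  _   = ℚₚ.≤-refl
sumℚ-mono-≤ {suc n} g≤h = ℚₚ.+-mono-≤ (g≤h zero) (sumℚ-mono-≤ (g≤h ∘ suc))

sumℚ-nonneg : ∀ {n} {g : Fin n → ℚ} → (∀ k → 0ℚ ℚ.≤ g k) → 0ℚ ℚ.≤ ℚΣ.sum g
sumℚ-nonneg {n} g≥0 = ℚₚ.≤-trans (ℚₚ.≤-reflexive (sym (ℚΣ.sum-replicate-zero n))) (sumℚ-mono-≤ g≥0)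

term≤sumℚ : ∀ {n} {g : Fin n → ℚ} → (∀ k → 0ℚ ℚ.≤ g k) → ∀ k → g k ℚ.≤ ℚΣ.sum g
term≤sumℚ {suc n} {g} g≥0 k = begin
  g k                                ≡⟨ ℚₚ.+-identityʳ (g k) ⟨
  g k ℚ.+ 0ℚ                         ≤⟨ ℚₚ.+-monoʳ-≤ (g k) (sumℚ-nonneg (g≥0 ∘ punchIn k)) ⟩
  g k ℚ.+ ℚΣ.sum (g ∘ punchIn k)     ≡⟨ ℚΣ.sum-remove {i = k} g ⟨
  ℚΣ.sum g                           ∎
  where open ℚₚ.≤-Reasoning

fromℕ : ℕ → ℚ
fromℕ k = fromℤ (+ k)

fromℕ-+ : ∀ a b → fromℕ (a + b) ≡ fromℕ a ℚ.+ fromℕ b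
fromℕ-+ a b = ℚₚ.toℚᵘ-injective (ℚᵘₚ.≃-trans (*≡* eq) (ℚᵘₚ.≃-sym (ℚₚ.toℚᵘ-homo-+ (fromℕ a) (fromℕ b))))
  where
  eq : + (a + b) ℤ.* + 1 ≡ (+ a ℤ.* + 1 ℤ.+ + b ℤ.* + 1) ℤ.* + 1
  eq = cong (ℤ._* + 1) (trans (ℤₚ.pos-+ a b) (sym (cong₂ ℤ._+_ (ℤₚ.*-identityʳ (+ a)) (ℤₚ.*-identityʳ (+ b)))))

fromℕ-sum : ∀ {n} (g : Fin n → ℕ) → fromℕ (sum g) ≡ ℚΣ.sum (fromℕ ∘ g)
fromℕ-sum {zero}  g = refl
fromℕ-sum {suc n} g = trans (fromℕ-+ (g zero) _) (cong (fromℕ (g zero) ℚ.+_) (fromℕ-sum (g ∘ suc)))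

fromℕ-mono-≤ : ∀ {a b} → a ≤ b → fromℕ a ℚ.≤ fromℕ b
fromℕ-mono-≤ {a} {b} a≤b = ℚ.*≤* (subst₂ ℤ._≤_ (sym (ℤₚ.*-identityʳ (+ a))) (sym (ℤₚ.*-identityʳ (+ b))) (ℤ.+≤+ a≤b))

fromℕ-cancel-≤ : ∀ {a b} → fromℕ a ℚ.≤ fromℕ b → a ≤ b
fromℕ-cancel-≤ {a} {b} (ℚ.*≤* le) = ℤₚ.drop‿+≤+ (subst₂ ℤ._≤_ (ℤₚ.*-identityʳ (+ a)) (ℤₚ.*-identityʳ (+ b)) le)

fromℕ-cancel-< : ∀ {a b} → fromℕ a ℚ.< fromℕ b → a < b
fromℕ-cancel-< {a} {b} (ℚ.*<* lt) = ℤₚ.drop‿+<+ (subst₂ ℤ._<_ (ℤₚ.*-identityʳ (+ a)) (ℤₚ.*-identityʳ (+ b)) lt)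

≤-fromℕ-⊓ : ∀ {x a b} → x ℚ.≤ fromℕ a → x ℚ.≤ fromℕ b → x ℚ.≤ fromℕ (a ⊓ b)
≤-fromℕ-⊓ {x} {a} {b} x≤a x≤b with ℕₚ.⊓-sel a b
... | inj₁ a⊓b≡a = subst (λ y → x ℚ.≤ fromℕ y) (sym a⊓b≡a) x≤a
... | inj₂ a⊓b≡b = subst (λ y → x ℚ.≤ fromℕ y) (sym a⊓b≡b) x≤b

if-nonneg : ∀ b {x} → 0ℚ ℚ.≤ x → 0ℚ ℚ.≤ (if b then x else 0ℚ)
if-nonneg true  x≥0 = x≥0
if-nonneg false _   = ℚₚ.≤-refl

if≡*𝟙 : ∀ b x → (if b then x else 0ℚ) ≡ x ℚ.* fromℕ (𝟙 b)
if≡*𝟙 true  x = sym (ℚₚ.*-identityʳ x)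
if≡*𝟙 false x = sym (ℚₚ.*-zeroʳ x)

reciprocal-inverse : ∀ k → (+ 1 ℚ./ suc k) ℚ.* fromℕ (suc k) ≡ 1ℚ
reciprocal-inverse k =
  trans (cong (ℚ._* fromℕ (suc k)) (ℚₚ.↥p/↧p≡p (ℚ.1/ fromℕ (suc k)))) (ℚₚ.*-inverseˡ (fromℕ (suc k)))

reciprocal-nonneg : ∀ k → 0ℚ ℚ.≤ + 1 ℚ./ suc k
reciprocal-nonneg k = ℚₚ.nonNegative⁻¹ _ {{ℚₚ.normalize-nonNeg 1 (suc k)}}

÷-*-cancel : ∀ p q .{{_ : ℚ.NonZero q}} → (p ℚ.÷ q) ℚ.* q ≡ p
÷-*-cancel p q = begin
  p ℚ.* ℚ.1/ q ℚ.* q        ≡⟨ ℚₚ.*-assoc p (ℚ.1/ q) q ⟩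
  p ℚ.* (ℚ.1/ q ℚ.* q)      ≡⟨ cong (p ℚ.*_) (ℚₚ.*-inverseˡ q) ⟩
  p ℚ.* 1ℚ                  ≡⟨ ℚₚ.*-identityʳ p ⟩
  p                         ∎
  where open ≡-Reasoning

÷-positive : ∀ {p q} → 0ℚ ℚ.< p → (q>0 : 0ℚ ℚ.< q) → 0ℚ ℚ.< ℚ._÷_ p q {{ℚ.>-nonZero q>0}}
÷-positive {p} {q} p>0 q>0 = ℚₚ.positive⁻¹ _
  {{ℚₚ.pos*pos⇒pos p {{ℚ.positive p>0}} (ℚ.1/_ q {{ℚ.>-nonZero q>0}}) {{ℚₚ.1/pos⇒pos q {{ℚ.positive q>0}}}}}}

-- Since ⌈p⌉ = -⌊-p⌋, the division theorem for -↥p gives ↥p + r = ⌈p⌉·↧p with 0 ≤ r < ↧p.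
positive-ceiling : ∀ p → 0ℚ ℚ.< p → ∃ λ k → ℚ.ceiling p ≡ +[1+ k ] × fromℕ k ℚ.< p
positive-ceiling (ℚ.mkℚ (+ zero)   _ _) (ℚ.*<* (ℤ.+<+ ()))
positive-ceiling (ℚ.mkℚ -[1+ _ ]   _ _) (ℚ.*<* ())
positive-ceiling p@(ℚ.mkℚ +[1+ a ] d _) _ =
  ceiling-of (-[1+ a ] /ℤ + suc d) (a≡a%n+[a/n]*n -[1+ a ] (+ suc d)) (n%d<d -[1+ a ] (+ suc d))
  where
  ceiling-of : ∀ f {r} → -[1+ a ] ≡ + r ℤ.+ f ℤ.* + suc d → r < suc d →
               ∃ λ k → ℤ.- f ≡ +[1+ k ] × fromℕ k ℚ.< p
  ceiling-of (+ x) {r} eq _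
    with () ← trans eq (trans (cong (λ y → + r ℤ.+ y) (sym (ℤₚ.pos-* x (suc d)))) (sym (ℤₚ.pos-+ r _)))
  ceiling-of -[1+ s ] {r} eq r<d =
    s , refl , ℚ.*<* (subst₂ ℤ._<_ (ℤₚ.pos-* s (suc d)) (ℤₚ.pos-* (suc a) 1) (ℤ.+<+ s·d<a))
    where
    numerator-eq : suc a + r ≡ suc d + s ℕ.* suc d
    numerator-eq = ℤₚ.+-injective (begin
      + (suc a + r)                                  ≡⟨ ℤₚ.pos-+ (suc a) r ⟩
      ℤ.- -[1+ a ] ℤ.+ + r                           ≡⟨ cong (λ x → ℤ.- x ℤ.+ + r) eq ⟩
      ℤ.- (+ r ℤ.+ -[1+ s ] ℤ.* + suc d) ℤ.+ + r     ≡⟨ cancel (+ r) -[1+ s ] (+ suc d) ⟩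
      +[1+ s ] ℤ.* + suc d                           ≡⟨ ℤₚ.pos-* (suc s) (suc d) ⟨
      + (suc s ℕ.* suc d)                            ∎)
      where
      open ≡-Reasoning
      cancel : ∀ x y z → ℤ.- (x ℤ.+ y ℤ.* z) ℤ.+ x ≡ ℤ.- y ℤ.* z
      cancel = solve-∀
    s·d<a : s ℕ.* suc d < suc a ℕ.* 1
    s·d<a = subst (s ℕ.* suc d <_) (sym (ℕₚ.*-identityʳ (suc a))) (ℕₚ.+-cancelˡ-< (suc d) _ _ (begin-strict
      suc d + s ℕ.* suc d     ≡⟨ numerator-eq ⟨
      suc a + r               <⟨ ℕₚ.+-monoʳ-< (suc a) r<d ⟩
      suc a + suc d           ≡⟨ ℕₚ.+-comm (suc a) (suc d) ⟩
      suc d + suc a           ∎))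
      where open ℕₚ.≤-Reasoning

sum∞-fin : ∀ {n} {g : Fin n → ℚ∞} (h : Fin n → ℚ) → (∀ j → g j ≡ fin (h j)) → sum∞ g ≡ fin (ℚΣ.sum h)
sum∞-fin {zero}  h _     = refl
sum∞-fin {suc n} h g≡h rewrite g≡h zero | sum∞-fin (h ∘ suc) (g≡h ∘ suc) = refl

sum∞-∞ : ∀ {n} (g : Fin n → ℚ∞) (j : Fin n) → g j ≡ ∞ → sum∞ g ≡ ∞
sum∞-∞ g zero    gj rewrite gj = refl
sum∞-∞ g (suc j) gj rewrite sum∞-∞ (g ∘ suc) j gj with g zero
... | fin _ = refl
... | ∞     = refl

if-fin : ∀ b {x y} → x ≡ fin y → (if b then x else fin 0ℚ) ≡ fin (if b then y else 0ℚ)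
if-fin true  x≡y = x≡y
if-fin false _   = refl

fin-≤∞⁻¹ : ∀ {x y} → fin x ≤∞ fin y → x ℚ.≤ y
fin-≤∞⁻¹ (fin≤fin x≤y) = x≤y


-- Fractional matchings

module _ {m n : ℕ} where

  fractional⇒hall : ∀ {A : Fin n → Fin m → Bool} {d c P} (w : Fin n → Fin m → ℚ) →
                    (∀ j i → 0ℚ ℚ.≤ w j i) → (∀ j i → w j i ℚ.≤ fromℕ (𝟙 (A j i))) →
                    (∀ j → P j ≡ true → ℚΣ.sum (w j) ≡ fromℕ (d j)) →
                    (∀ i → ℚΣ.sum (λ j → w j i) ℚ.≤ fromℕ (c i)) →
                    HallCondition A d c P
  fractional⇒hall {A} {d} {c} {P} w w≥0 w≤A column row K K⊆P = fromℕ-cancel-≤ (begin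
    fromℕ (∑[ j ∈ lookup K ] d j)                          ≡⟨ fromℕ-sum (λ j → if lookup K j then d j else 0) ⟩
    ℚΣ.sum (λ j → fromℕ (if lookup K j then d j else 0))   ≡⟨ ℚΣ.sum-cong-≗ column-K ⟩
    ℚΣ.sum (λ j → ℚΣ.sum (wK j))                           ≡⟨ ℚΣ.∑-comm wK ⟩
    ℚΣ.sum (λ i → ℚΣ.sum (λ j → wK j i))                   ≤⟨ sumℚ-mono-≤ (λ i → ≤-fromℕ-⊓ (row-K i) (degree-K i)) ⟩
    ℚΣ.sum (λ i → fromℕ (c i ⊓ degree A (lookup K) i))     ≡⟨ fromℕ-sum (λ i → c i ⊓ degree A (lookup K) i) ⟨
    fromℕ (supply A c (lookup K))                          ∎)
    where
    open ℚₚ.≤-Reasoning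
    wK : Fin n → Fin m → ℚ
    wK j i = if lookup K j then w j i else 0ℚ
    column-K : ∀ j → fromℕ (if lookup K j then d j else 0) ≡ ℚΣ.sum (wK j)
    column-K j with lookup K j in Kj
    ... | true  = sym (column j (K⊆P j Kj))
    ... | false = sym (ℚΣ.sum-replicate-zero m)
    row-K : ∀ i → ℚΣ.sum (λ j → wK j i) ℚ.≤ fromℕ (c i)
    row-K i = ℚₚ.≤-trans (sumℚ-mono-≤ λ j → restricted (lookup K j) j) (row i)
      where
      restricted : ∀ b j → (if b then w j i else 0ℚ) ℚ.≤ w j i
      restricted true  j = ℚₚ.≤-refl
      restricted false j = w≥0 j i
    degree-K : ∀ i → ℚΣ.sum (λ j → wK j i) ℚ.≤ fromℕ (degree A (lookup K) i)
    degree-K i = ℚₚ.≤-trans (sumℚ-mono-≤ λ j → restricted (lookup K j) j)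
                            (ℚₚ.≤-reflexive (sym (fromℕ-sum λ j → if lookup K j then 𝟙 (A j i) else 0)))
      where
      restricted : ∀ b j → (if b then w j i else 0ℚ) ℚ.≤ fromℕ (if b then 𝟙 (A j i) else 0)
      restricted true  j = w≤A j i
      restricted false j = ℚₚ.≤-refl


-- The fractional assignment given by bases of the S_j

module Construction {m n : ℕ} (F : Fin n → Family m) (r : Fin n → Subset m → ℕ)
  (matroid : ∀ j → IsMatroid (F j)) (rank : ∀ j → IsRankFunction (F j) (r j))
  (q : Fin n → ℚ) (q>0 : ∀ j → 0ℚ ℚ.< q j) (C : ℚ) (C>0 : 0ℚ ℚ.< C)
  (S : Fin n → Subset m) (S≢∅ : ∀ j → Nonempty (S j)) (load≤C : ∀ i → load q r S i ≤∞ fin C) where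

  t : Fin n → ℕ
  t j = tval C C>0 (q j)

  P : Fin n → Bool
  P = lookup (J₂ t)

  R : Fin n → ℕ
  R j = r j (S j)

  basis : ∀ j → ∃ λ T → T ⊆ S j × F j T × ∣ T ∣ ≡ R j
  basis j = proj₁ (rank j (S j))

  T : Fin n → Subset m
  T j = proj₁ (basis j)

  T⊆S : ∀ j → T j ⊆ S j
  T⊆S j = proj₁ (proj₂ (basis j))

  T∈F : ∀ j → F j (T j)
  T∈F j = proj₁ (proj₂ (proj₂ (basis j)))

  ∣T∣≡R : ∀ j → ∣ T j ∣ ≡ R j
  ∣T∣≡R j = proj₂ (proj₂ (proj₂ (basis j)))

  rank-positive : ∀ j → ∃ λ ρ → R j ≡ suc ρ
  rank-positive j with S≢∅ j | R j in Rj
  ... | _ , _   | suc ρ = ρ , refl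
  ... | i , i∈S | zero  = ⊥-elim (∞≰fin (subst (_≤∞ fin C) load≡∞ (load≤C i)))
    where
    infinite-cost : ∀ b → b ≡ true → (if b then cost (q j) (R j) else fin 0ℚ) ≡ ∞
    infinite-cost true _ rewrite Rj = refl
    load≡∞ : load q r S i ≡ ∞
    load≡∞ = sum∞-∞ _ j (infinite-cost (lookup (S j) i) ([]=⇒lookup i∈S))
    ∞≰fin : ¬ (∞ ≤∞ fin C)
    ∞≰fin ()

  ρ : Fin n → ℕ
  ρ j = proj₁ (rank-positive j)

  1/R : Fin n → ℚ
  1/R j = + 1 ℚ./ suc (ρ j)

  1/R*R≡1 : ∀ j → 1/R j ℚ.* fromℕ (R j) ≡ 1ℚ
  1/R*R≡1 j = trans (cong (λ x → 1/R j ℚ.* fromℕ x) (proj₂ (rank-positive j))) (reciprocal-inverse (ρ j))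

  instance
    C-positive : ℚ.Positive C
    C-positive = ℚ.positive C>0

    C-nonNegative : ℚ.NonNegative C
    C-nonNegative = ℚₚ.pos⇒nonNeg C

    C-nonZero : ℚ.NonZero C
    C-nonZero = ℚ.>-nonZero C>0

    q-nonNegative : ∀ {j} → ℚ.NonNegative (q j)
    q-nonNegative {j} = ℚ.nonNegative (ℚₚ.<⇒≤ (q>0 j))

    1/R-nonNegative : ∀ {j} → ℚ.NonNegative (1/R j)
    1/R-nonNegative {j} = ℚ.nonNegative (reciprocal-nonneg (ρ j))

  share : Fin n → ℚ
  share j = q j ℚ.* 1/R j

  cost≡share : ∀ j → cost (q j) (R j) ≡ fin (share j)
  cost≡share j = cong (cost (q j)) (proj₂ (rank-positive j))

  share≥0 : ∀ j → 0ℚ ℚ.≤ share j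
  share≥0 j = ℚₚ.nonNegative⁻¹ _ {{ℚₚ.nonNeg*nonNeg⇒nonNeg (q j) (1/R j)}}

  machine-share : Fin m → Fin n → ℚ
  machine-share i j = if lookup (S j) i then share j else 0ℚ

  machine-share≥0 : ∀ i j → 0ℚ ℚ.≤ machine-share i j
  machine-share≥0 i j = if-nonneg (lookup (S j) i) (share≥0 j)

  machine-load≤C : ∀ i → ℚΣ.sum (machine-share i) ℚ.≤ C
  machine-load≤C i = fin-≤∞⁻¹ (subst (_≤∞ fin C) (sum∞-fin (machine-share i) finite-cost) (load≤C i))
    where
    finite-cost : ∀ j → (if lookup (S j) i then cost (q j) (R j) else fin 0ℚ) ≡ fin (machine-share i j)
    finite-cost j = if-fin (lookup (S j) i) (cost≡share j)

  share≤C : ∀ j → share j ℚ.≤ C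
  share≤C j = via (S≢∅ j)
    where
    via : Nonempty (S j) → share j ℚ.≤ C
    via (i , i∈S) = begin
      share j                       ≡⟨ cong (λ b → if b then share j else 0ℚ) ([]=⇒lookup i∈S) ⟨
      machine-share i j             ≤⟨ term≤sumℚ (machine-share≥0 i) j ⟩
      ℚΣ.sum (machine-share i)      ≤⟨ machine-load≤C i ⟩
      C                             ∎
      where open ℚₚ.≤-Reasoning

  q≤C*R : ∀ j → q j ℚ.≤ C ℚ.* fromℕ (R j)
  q≤C*R j = begin
    q j                               ≡⟨ ℚₚ.*-identityʳ (q j) ⟨
    q j ℚ.* 1ℚ                        ≡⟨ cong (q j ℚ.*_) (1/R*R≡1 j) ⟨
    q j ℚ.* (1/R j ℚ.* fromℕ (R j))   ≡⟨ ℚₚ.*-assoc (q j) (1/R j) (fromℕ (R j)) ⟨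
    share j ℚ.* fromℕ (R j)           ≤⟨ ℚₚ.*-monoʳ-≤-nonNeg (fromℕ (R j)) (share≤C j) ⟩
    C ℚ.* fromℕ (R j)                 ∎
    where open ℚₚ.≤-Reasoning

  t-ceiling : ∀ j → ∃ λ k → t j ≡ suc k × fromℕ k ℚ.* C ℚ.< q j
  t-ceiling j with positive-ceiling (q j ℚ.÷ C) (÷-positive (q>0 j) C>0)
  ... | k , ceiling≡ , k<q/C = k , cong ℤ.∣_∣ ceiling≡ , (begin-strict
    fromℕ k ℚ.* C      <⟨ ℚₚ.*-monoˡ-<-pos C k<q/C ⟩
    q j ℚ.÷ C ℚ.* C    ≡⟨ ÷-*-cancel (q j) C ⟩
    q j                ∎)
    where open ℚₚ.≤-Reasoning

  κ : Fin n → ℕ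
  κ j = proj₁ (t-ceiling j)

  t≡1+κ : ∀ j → t j ≡ suc (κ j)
  t≡1+κ j = proj₁ (proj₂ (t-ceiling j))

  κC<q : ∀ j → fromℕ (κ j) ℚ.* C ℚ.< q j
  κC<q j = proj₂ (proj₂ (t-ceiling j))

  t≤R : ∀ j → t j ≤ R j
  t≤R j = subst (_≤ R j) (sym (t≡1+κ j)) (fromℕ-cancel-< (ℚₚ.*-cancelʳ-<-nonNeg C (begin-strict
    fromℕ (κ j) ℚ.* C      <⟨ κC<q j ⟩
    q j                    ≤⟨ q≤C*R j ⟩
    C ℚ.* fromℕ (R j)      ≡⟨ ℚₚ.*-comm C (fromℕ (R j)) ⟩
    fromℕ (R j) ℚ.* C      ∎)))
    where open ℚₚ.≤-Reasoning

  t*C≤q+q : ∀ j → P j ≡ true → fromℕ (t j) ℚ.* C ℚ.≤ q j ℚ.+ q j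
  t*C≤q+q j Pj = begin
    fromℕ (t j) ℚ.* C                             ≤⟨ ℚₚ.*-monoʳ-≤-nonNeg C (fromℕ-mono-≤ t≤κ+κ) ⟩
    fromℕ (κ j + κ j) ℚ.* C                       ≡⟨ cong (ℚ._* C) (fromℕ-+ (κ j) (κ j)) ⟩
    (fromℕ (κ j) ℚ.+ fromℕ (κ j)) ℚ.* C           ≡⟨ ℚₚ.*-distribʳ-+ C (fromℕ (κ j)) (fromℕ (κ j)) ⟩
    fromℕ (κ j) ℚ.* C ℚ.+ fromℕ (κ j) ℚ.* C       <⟨ ℚₚ.+-mono-< (κC<q j) (κC<q j) ⟩
    q j ℚ.+ q j                                   ∎
    where
    open ℚₚ.≤-Reasoning
    t≢1 : not (suc (κ j) ℕ.≡ᵇ 1) ≡ true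
    t≢1 = subst (λ x → not (x ℕ.≡ᵇ 1) ≡ true) (t≡1+κ j)
                (trans (sym (lookup∘tabulate (λ j → not (t j ℕ.≡ᵇ 1)) j)) Pj)
    t≤κ+κ : t j ≤ κ j + κ j
    t≤κ+κ = subst (_≤ κ j + κ j) (sym (t≡1+κ j)) (suc≤double (κ j) t≢1)

  A : Fin n → Fin m → Bool
  A j = lookup (T j)

  w : Fin n → Fin m → ℚ
  w j i = if P j ∧ A j i then fromℕ (t j) ℚ.* 1/R j else 0ℚ

  t/R≥0 : ∀ j → 0ℚ ℚ.≤ fromℕ (t j) ℚ.* 1/R j
  t/R≥0 j = ℚₚ.nonNegative⁻¹ _ {{ℚₚ.nonNeg*nonNeg⇒nonNeg (fromℕ (t j)) (1/R j)}}

  w≥0 : ∀ j i → 0ℚ ℚ.≤ w j i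
  w≥0 j i = if-nonneg (P j ∧ A j i) (t/R≥0 j)

  t/R≤1 : ∀ j → fromℕ (t j) ℚ.* 1/R j ℚ.≤ 1ℚ
  t/R≤1 j = begin
    fromℕ (t j) ℚ.* 1/R j     ≤⟨ ℚₚ.*-monoʳ-≤-nonNeg (1/R j) (fromℕ-mono-≤ (t≤R j)) ⟩
    fromℕ (R j) ℚ.* 1/R j     ≡⟨ ℚₚ.*-comm (fromℕ (R j)) (1/R j) ⟩
    1/R j ℚ.* fromℕ (R j)     ≡⟨ 1/R*R≡1 j ⟩
    1ℚ                        ∎
    where open ℚₚ.≤-Reasoning

  w≤A : ∀ j i → w j i ℚ.≤ fromℕ (𝟙 (A j i))
  w≤A j i = bound (P j) (A j i)
    where
    bound : ∀ p a → (if p ∧ a then fromℕ (t j) ℚ.* 1/R j else 0ℚ) ℚ.≤ fromℕ (𝟙 a)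
    bound true  true  = t/R≤1 j
    bound true  false = ℚₚ.≤-refl
    bound false a     = ℚₚ.nonNegative⁻¹ _

  w-column : ∀ j → P j ≡ true → ℚΣ.sum (w j) ≡ fromℕ (t j)
  w-column j Pj = begin
    ℚΣ.sum (w j)                                 ≡⟨ ℚΣ.sum-cong-≗ per-machine ⟩
    ℚΣ.sum (λ i → t/R ℚ.* fromℕ (𝟙 (A j i)))     ≡⟨ ℚΣ.*-distribˡ-sum t/R (fromℕ ∘ 𝟙 ∘ A j) ⟨
    t/R ℚ.* ℚΣ.sum (fromℕ ∘ 𝟙 ∘ A j)             ≡⟨ cong (t/R ℚ.*_) size-T ⟩
    t/R ℚ.* fromℕ (R j)                          ≡⟨ ℚₚ.*-assoc (fromℕ (t j)) (1/R j) (fromℕ (R j)) ⟩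
    fromℕ (t j) ℚ.* (1/R j ℚ.* fromℕ (R j))      ≡⟨ cong (fromℕ (t j) ℚ.*_) (1/R*R≡1 j) ⟩
    fromℕ (t j) ℚ.* 1ℚ                           ≡⟨ ℚₚ.*-identityʳ (fromℕ (t j)) ⟩
    fromℕ (t j)                                  ∎
    where
    open ≡-Reasoning
    t/R = fromℕ (t j) ℚ.* 1/R j
    per-machine : ∀ i → w j i ≡ t/R ℚ.* fromℕ (𝟙 (A j i))
    per-machine i = trans (cong (λ p → if p ∧ A j i then t/R else 0ℚ) Pj) (if≡*𝟙 (A j i) t/R)
    size-T : ℚΣ.sum (fromℕ ∘ 𝟙 ∘ A j) ≡ fromℕ (R j)
    size-T = trans (sym (fromℕ-sum (𝟙 ∘ A j))) (cong fromℕ (trans (sym (∣p∣≡count (T j))) (∣T∣≡R j)))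

  w-row : ∀ i → ℚΣ.sum (λ j → w j i) ℚ.≤ fromℕ 2
  w-row i = ℚₚ.*-cancelˡ-≤-pos C (begin
    C ℚ.* ℚΣ.sum (λ j → w j i)                               ≡⟨ ℚΣ.*-distribˡ-sum C (λ j → w j i) ⟩
    ℚΣ.sum (λ j → C ℚ.* w j i)                               ≤⟨ sumℚ-mono-≤ per-job ⟩
    ℚΣ.sum (λ j → machine-share i j ℚ.+ machine-share i j)   ≡⟨ ℚΣ.∑-distrib-+ (machine-share i) (machine-share i) ⟩
    ℚΣ.sum (machine-share i) ℚ.+ ℚΣ.sum (machine-share i)   ≤⟨ ℚₚ.+-mono-≤ (machine-load≤C i) (machine-load≤C i) ⟩
    C ℚ.+ C                                                  ≡⟨ cong₂ ℚ._+_ (ℚₚ.*-identityʳ C) (ℚₚ.*-identityʳ C) ⟨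
    C ℚ.* 1ℚ ℚ.+ C ℚ.* 1ℚ                                    ≡⟨ ℚₚ.*-distribˡ-+ C 1ℚ 1ℚ ⟨
    C ℚ.* (1ℚ ℚ.+ 1ℚ)                                        ≡⟨ cong (C ℚ.*_) (fromℕ-+ 1 1) ⟨
    C ℚ.* fromℕ 2                                            ∎)
    where
    open ℚₚ.≤-Reasoning
    no-share : ∀ j → C ℚ.* 0ℚ ℚ.≤ machine-share i j ℚ.+ machine-share i j
    no-share j = ℚₚ.≤-trans (ℚₚ.≤-reflexive (trans (ℚₚ.*-zeroʳ C) (sym (ℚₚ.+-identityʳ 0ℚ))))
                            (ℚₚ.+-mono-≤ (machine-share≥0 i j) (machine-share≥0 i j))
    per-job : ∀ j → C ℚ.* w j i ℚ.≤ machine-share i j ℚ.+ machine-share i j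
    per-job j = bound (P j) (A j i) refl refl
      where
      bound : ∀ p a → P j ≡ p → A j i ≡ a →
              C ℚ.* (if p ∧ a then fromℕ (t j) ℚ.* 1/R j else 0ℚ) ℚ.≤ machine-share i j ℚ.+ machine-share i j
      bound false _     _  _   = no-share j
      bound true  false _  _   = no-share j
      bound true  true  Pj Aji = begin
        C ℚ.* (fromℕ (t j) ℚ.* 1/R j)             ≡⟨ ℚₚ.*-assoc C (fromℕ (t j)) (1/R j) ⟨
        C ℚ.* fromℕ (t j) ℚ.* 1/R j               ≡⟨ cong (ℚ._* 1/R j) (ℚₚ.*-comm C (fromℕ (t j))) ⟩
        fromℕ (t j) ℚ.* C ℚ.* 1/R j               ≤⟨ ℚₚ.*-monoʳ-≤-nonNeg (1/R j) (t*C≤q+q j Pj) ⟩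
        (q j ℚ.+ q j) ℚ.* 1/R j                   ≡⟨ ℚₚ.*-distribʳ-+ (1/R j) (q j) (q j) ⟩
        share j ℚ.+ share j                       ≡⟨ cong (λ b → share-if b ℚ.+ share-if b) i∈Sj ⟨
        machine-share i j ℚ.+ machine-share i j   ∎
        where
        share-if : Bool → ℚ
        share-if b = if b then share j else 0ℚ
        i∈Sj : lookup (S j) i ≡ true
        i∈Sj = []=⇒lookup (T⊆S j (lookup⇒[]= i (T j) Aji))

  hall-condition : HallCondition A t (λ _ → 2) P
  hall-condition = fractional⇒hall w w≥0 w≤A w-column w-row

  open Matching (hall {A = A} {d = t} {c = λ _ → 2} {P = P} hall-condition)

  B : Fin n → Subset m
  B j = tabulate λ i → P j ∧ edge j i

  B-lookup : ∀ j i → lookup (B j) i ≡ (P j ∧ edge j i)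
  B-lookup j = lookup∘tabulate (λ i → P j ∧ edge j i)

  ∈B⇒P∧edge : ∀ {j i} → i ∈ B j → (P j ∧ edge j i) ≡ true
  ∈B⇒P∧edge {j} {i} i∈B = trans (sym (B-lookup j i)) ([]=⇒lookup i∈B)

  ∣B∣ : ∀ j → ∣ B j ∣ ≡ (if P j then t j else 0)
  ∣B∣ j = trans (∣p∣≡count (B j)) (trans (sum-cong-≗ (cong 𝟙 ∘ B-lookup j)) (by-P (P j) refl))
    where
    by-P : ∀ b → P j ≡ b → count (λ i → b ∧ edge j i) ≡ (if b then t j else 0)
    by-P true  Pj = saturated j Pj
    by-P false _  = sum-replicate-zero m

  B-ground : InGround (J₂ t) B
  B-ground j j∉J₂ i i∈B = j∉J₂ (lookup⇒[]= j (J₂ t) (∧-conicalˡ (P j) (edge j i) (∈B⇒P∧edge i∈B)))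

  B∈F′ : InF′ F t B
  B∈F′ j j∈J₂ = IsMatroid.down (matroid j) B⊆T (T∈F j)
              , ℕₚ.≤-reflexive (trans (∣B∣ j) (cong (λ b → if b then t j else 0) Pj))
    where
    Pj : P j ≡ true
    Pj = []=⇒lookup j∈J₂
    B⊆T : B j ⊆ T j
    B⊆T {i} i∈B = lookup⇒[]= i (T j) (edge⊆A j i (∧-conicalʳ (P j) (edge j i) (∈B⇒P∧edge i∈B)))

  B∈F″ : InF″ t B
  B∈F″ i = begin
    ∣ row (J₂ t) B i ∣                    ≡⟨ ∣p∣≡count (row (J₂ t) B i) ⟩
    count (lookup (row (J₂ t) B i))       ≡⟨ sum-cong-≗ per-job ⟩
    degree edge P i                       ≤⟨ within i ⟩
    2                                     ∎
    where
    open ℕₚ.≤-Reasoning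
    per-job : ∀ j → 𝟙 (lookup (row (J₂ t) B i) j) ≡ (if P j then 𝟙 (edge j i) else 0)
    per-job j = trans (cong 𝟙 (trans (lookup∘tabulate (λ j → if P j then lookup (B j) i else false) j)
                                     (cong (λ x → if P j then x else false) (B-lookup j i))))
                      (restrict (P j))
      where
      restrict : ∀ b → 𝟙 (if b then b ∧ edge j i else false) ≡ (if b then 𝟙 (edge j i) else 0)
      restrict true  = refl
      restrict false = refl

  card-B : card B ≡ sumJ₂ t
  card-B = begin
    sumℕ (∣_∣ ∘ B)                         ≡⟨ sumℕ≡sum (∣_∣ ∘ B) ⟩
    sum (∣_∣ ∘ B)                          ≡⟨ sum-cong-≗ ∣B∣ ⟩
    sum (λ j → if P j then t j else 0)     ≡⟨ sumℕ≡sum (λ j → if P j then t j else 0) ⟨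
    sumJ₂ t                                ∎
    where open ≡-Reasoning

lemma8 : (m n : ℕ) (F : Fin n → Family m) (r : Fin n → Subset m → ℕ)
         → (∀ j → IsMatroid (F j)) → (∀ j → IsRankFunction (F j) (r j))
         → (q : Fin n → ℚ) → (∀ j → 0ℚ ℚ.< q j)
         → (C : ℚ) → (C>0 : 0ℚ ℚ.< C)
         → (∃ λ (S : Fin n → Subset m) → (∀ j → Nonempty (S j))
              × (∀ i → load q r S i ≤∞ fin C))
         → ∃ λ (B : Fin n → Subset m)
             → InGround (J₂ (λ j → tval C C>0 (q j))) B
             × InF′ F (λ j → tval C C>0 (q j)) B
             × InF″ (λ j → tval C C>0 (q j)) B
             × card B ≡ sumJ₂ (λ j → tval C C>0 (q j))
lemma8 m n F r matroid rank q q>0 C C>0 (S , S≢∅ , load≤C) = B , B-ground , B∈F′ , B∈F″ , card-B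
  where open Construction F r matroid rank q q>0 C C>0 S S≢∅ load≤C
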